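{- Let $G$ be a connected block graph, let $k\ge 0$ be an integer, and let $H$ be its block--cutpoint tree with vertex set $A\cup\mathcal{B}'$. If $X\subseteq V(G)$ is a mutual $k$-visible set, then $$Z=(X\cap A)\cup\{\, b\in \mathcal{B}': X\cap (V(B_b)\setminus A)\neq\emptyset \,\}$$ is $k$-admissible.
   Context: A block of $G$ is a maximal 2-connected subgraph (maximal connected subgraph without a cut vertex); $G$ is a block graph if every block is a clique. $A$ denotes the set of articulation (cut) vertices of $G$. The block--cutpoint tree $H$ is the bipartite graph with vertex set $A\cup\mathcal{B}'$, where $\mathcal{B}'$ has one vertex $b$ for each block $B_b$ of $G$, and $vb\in E(H)$ iff $v\in A\cap V(B_b)$; it is a tree when $G$ is connected. A subset $Z\subseteq V(H)$ is $k$-admissible if for every pair of distinct $\alpha,\beta\in Z$, $\bigl|(V(P_H(\alpha,\beta))\setminus\{\alpha,\beta\})\cap(Z\cap A)\bigr|\le k$, where $P_H(\alpha,\beta)$ is the unique $(\alpha,\beta)$-path in $H$. For $X\subseteq V(G)$, vertices $u,v$ are $(X,k)$-visible if some shortest $(u,v)$-path in $G$ has at most $k$ internal vertices in $X$; $X$ is a mutual $k$-visible set if every pair of distinct vertices of $X$ is $(X,k)$-visible. -}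

module Defs where

open import Data.Nat using (ℕ; _≤_)
open import Data.Fin using (Fin)
open import Data.Fin.Subset using (Subset; _∈_; _⊆_)
open import Data.Fin.Subset.Properties using (_∈?_)
open import Data.List using (List; []; _∷_; length; filter; _∷ʳ_)
open import Data.List.Relation.Unary.All using (All)
open import Data.List.Relation.Unary.Unique.Propositional using (Unique)
import Data.List.Relation.Binary.Sublist.Propositional as SL
open import Data.Product using (Σ; ∃; ∃-syntax; _×_)
open import Data.Sum using (_⊎_)
open import Data.Unit using (⊤)
open import Data.Empty using (⊥)
open import Relation.Binary.PropositionalEquality using (_≡_; _≢_)
open import Relation.Nullary using (¬_)

record Graph (n : ℕ) : Set₁ where
  field
    Adj    : Fin n → Fin n → Set
    sym    : ∀ {u v} → Adj u v → Adj v u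
    irrefl : ∀ {u} → ¬ Adj u u

-- Walks over an arbitrary adjacency relation, indexed by endpoints and the
-- list of internal vertices.  A walk has at least one edge.
data Walk {V : Set} (R : V → V → Set) : V → V → List V → Set where
  edge : ∀ {u v} → R u v → Walk R u v []
  step : ∀ {u w v is} → R u w → Walk R w v is → Walk R u v (w ∷ is)

module _ {n : ℕ} (G : Graph n) where
  open Graph G

  -- u reaches v inside the subgraph induced by the vertex predicate P
  -- (endpoints are assumed to satisfy P separately).
  Reach : (Fin n → Set) → Fin n → Fin n → Set
  Reach P u v = u ≡ v ⊎ ∃[ is ] (Walk Adj u v is × All P is)

  ConnectedOn : (Fin n → Set) → Set
  ConnectedOn P = ∀ u v → P u → P v → Reach P u v

  Connected : Set
  Connected = ConnectedOn (λ _ → ⊤)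

  IsCutVertexOn : (Fin n → Set) → Fin n → Set
  IsCutVertexOn P c =
    P c × ∃[ u ] ∃[ v ] (P u × P v × u ≢ c × v ≢ c ×
      Reach P u v × ¬ Reach (λ w → P w × w ≢ c) u v)

  IsCut : Fin n → Set
  IsCut = IsCutVertexOn (λ _ → ⊤)

  TwoConn : Subset n → Set
  TwoConn S = (∃[ v ] v ∈ S) × ConnectedOn (_∈ S) × (∀ c → ¬ IsCutVertexOn (_∈ S) c)

  -- blocks: maximal connected subgraphs without a cut vertex
  -- (maximal subgraphs of this kind are induced, so they are given by vertex sets)
  IsBlock : Subset n → Set
  IsBlock S = TwoConn S × (∀ T → S ⊆ T → TwoConn T → T ⊆ S)

  IsClique : Subset n → Set
  IsClique S = ∀ u v → u ∈ S → v ∈ S → u ≢ v → Adj u v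

  IsBlockGraph : Set
  IsBlockGraph = ∀ S → IsBlock S → IsClique S

  IsShortest : Fin n → Fin n → List (Fin n) → Set
  IsShortest u v is = Walk Adj u v is × (∀ js → Walk Adj u v js → length is ≤ length js)

  countIn : Subset n → List (Fin n) → ℕ
  countIn X is = length (filter (_∈? X) is)

  Visible : Subset n → ℕ → Fin n → Fin n → Set
  Visible X k u v = ∃[ is ] (IsShortest u v is × countIn X is ≤ k)

  MutualVisible : Subset n → ℕ → Set
  MutualVisible X k = ∀ u v → u ∈ X → v ∈ X → u ≢ v → Visible X k u v

-- Candidate vertices of the block-cutpoint tree: a cut vertex, or a block
-- (given by its vertex set).
data HV (n : ℕ) : Set where
  cutV : Fin n → HV n
  blkV : Subset n → HV n

module _ {n : ℕ} (G : Graph n) where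

  IsHVertex : HV n → Set
  IsHVertex (cutV a) = IsCut G a
  IsHVertex (blkV S) = IsBlock G S

  InA : HV n → Set
  InA (cutV a) = IsCut G a
  InA (blkV S) = ⊥

  HAdj : HV n → HV n → Set
  HAdj (cutV a) (blkV S) = a ∈ S
  HAdj (blkV S) (cutV a) = a ∈ S
  HAdj _        _        = ⊥

  -- paths of H between α and β (internal vertices is); since H is a tree,
  -- this is the unique path P_H(α,β)
  HPath : HV n → HV n → List (HV n) → Set
  HPath α β is = Walk HAdj α β is × All IsHVertex is × Unique ((α ∷ is) ∷ʳ β)

  -- Z ⊆ V(H) is k-admissible: for distinct α, β ∈ Z, at most k internal
  -- vertices of P_H(α,β) lie in Z ∩ A (every sub-list of the internal
  -- vertices consisting of elements of Z ∩ A has length ≤ k).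
  KAdmissible : (HV n → Set) → ℕ → Set
  KAdmissible Z k =
    ∀ α β → Z α → Z β → α ≢ β → ∀ is → HPath α β is →
    ∀ js → js SL.⊆ is → All (λ x → Z x × InA x) js → length js ≤ k

  ZOf : Subset n → HV n → Set
  ZOf X (cutV a) = IsCut G a × a ∈ X
  ZOf X (blkV S) = IsBlock G S × ∃[ v ] (v ∈ S × ¬ IsCut G v × v ∈ X)

{-# OPTIONS --safe #-}

-- Every α ∈ Z has a representative u ∈ X: α itself if α is a cut vertex, otherwise a
-- non-cut vertex of X in the block α.  Let c be a cut vertex strictly inside P_H(α, β).
-- Its neighbours on that path are two distinct blocks B, B' through c, and walking along
-- the path (each block being 2-connected) links u to B and v to B' in G − c.  But two
-- distinct blocks through c cannot be joined in G − c: the blocks together with a simple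
-- joining path would form a larger 2-connected set.  So c separates u from v and lies on
-- every (u, v)-path, in particular on the shortest one with at most k internal vertices
-- in X given by mutual visibility.  The vertices of Z ∩ A on P_H(α, β) lie in X, so there
-- are at most k of them.

module Submission where

open import Defs
open import Level using (0ℓ)
open import Function using (_∘_; id)
open import Effect.Monad using (RawMonad)
open import Data.Nat using (ℕ; _≤_; z≤n)
open import Data.Nat.Properties using (≤-trans)
open import Data.Fin using (Fin; zero; suc)
open import Data.Fin.Properties using (_≟_; injective⇒≤)
open import Data.Fin.Subset using (Subset; _∈_; _⊆_; _∪_; ⁅_⁆) renaming (⊥ to ∅)
open import Data.Fin.Subset.Properties
  using (_∈?_; x∈p∪q⁻; x∈p∪q⁺; x∈⁅x⁆; x∈⁅y⁆⇒x≡y; ∉⊥; ⊆-antisym; p⊆p∪q; q⊆p∪q)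
open import Data.List using (List; []; _∷_; [_]; length; filter; map; lookup; _∷ʳ_)
open import Data.List.Properties using (length-map)
open import Data.List.Relation.Unary.All as All using (All; []; _∷_)
open import Data.List.Relation.Unary.All.Properties using (¬Any⇒All¬; anti-mono; ++⁺)
open import Data.List.Relation.Unary.Any using (here; there; index)
open import Data.List.Relation.Unary.Any.Properties using (lookup-index)
open import Data.List.Relation.Unary.Unique.Propositional using (Unique)
open import Data.List.Relation.Unary.AllPairs.Core using ([]; _∷_)
open import Data.List.Membership.Propositional using () renaming (_∈_ to _∈ₗ_)
open import Data.List.Membership.Propositional.Properties using (∈-filter⁺; ∈-map⁺; ∈-lookup; ∈-++⁺ˡ)
import Data.List.Membership.DecPropositional as DecMembership
open import Data.List.Relation.Binary.Subset.Propositional using () renaming (_⊆_ to _⊆ₛ_)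
import Data.List.Relation.Binary.Sublist.Propositional as SL
import Data.List.Relation.Binary.Sublist.Propositional.Properties as SLP using (++⁺ʳ; ++⁺)
open import Data.Product using (∃-syntax; ∃₂; _×_; _,_; proj₁; proj₂; map₁)
open import Data.Sum as Sum using (_⊎_; inj₁; inj₂)
open import Data.Empty using (⊥; ⊥-elim)
open import Relation.Binary.Definitions using (DecidableEquality; Symmetric)
open import Relation.Binary.PropositionalEquality using (_≡_; _≢_; refl; sym; trans; cong; subst)
open import Relation.Nullary using (¬_; yes; no)
open import Relation.Nullary.Decidable using (decidable-stable)
open import Relation.Nullary.Negation using (¬¬-Monad; DoubleNegation)

-- The no-cut-vertex clause of TwoConn is a negation, so 2-connectivity only yields
-- doubly negated paths; this suffices because every conclusion drawn from them is negative.
open RawMonad (¬¬-Monad {0ℓ}) using (pure; _<$>_; _>>=_)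

module _ {A : Set} where

  Unique-resp-⊇ : ∀ {xs ys : List A} → xs SL.⊆ ys → Unique ys → Unique xs
  Unique-resp-⊇ SL.[]             _         = []
  Unique-resp-⊇ (_ SL.∷ʳ σ)       (_ ∷ u)   = Unique-resp-⊇ σ u
  Unique-resp-⊇ (refl SL.∷ σ)     (y∉ ∷ u)  = anti-mono (SL.lookup σ) y∉ ∷ Unique-resp-⊇ σ u

  Unique-pair⇒≢ : ∀ {x y} {zs : List A} → x ∷ [ y ] SL.⊆ zs → Unique zs → x ≢ y
  Unique-pair⇒≢ σ u with Unique-resp-⊇ σ u
  ... | (x≢y ∷ []) ∷ _ = x≢y

  Unique-lookup-injective : ∀ {xs : List A} → Unique xs → ∀ {i j} → lookup xs i ≡ lookup xs j → i ≡ j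
  Unique-lookup-injective (_ ∷ _)  {zero}  {zero}  _  = refl
  Unique-lookup-injective (x∉ ∷ _) {zero}  {suc j} eq = ⊥-elim (All.lookup x∉ (∈-lookup j) eq)
  Unique-lookup-injective (x∉ ∷ _) {suc i} {zero}  eq = ⊥-elim (All.lookup x∉ (∈-lookup i) (sym eq))
  Unique-lookup-injective (_ ∷ u)  {suc i} {suc j} eq = cong suc (Unique-lookup-injective u eq)

  Unique-length-mono-≤ : ∀ {xs ys : List A} → Unique xs → xs ⊆ₛ ys → length xs ≤ length ys
  Unique-length-mono-≤ {xs} {ys} u xs⊆ys = injective⇒≤ position-injective
    where
    position : Fin (length xs) → Fin (length ys)
    position i = index (xs⊆ys (∈-lookup i))

    lookup-position : ∀ i → lookup xs i ≡ lookup ys (position i)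
    lookup-position i = lookup-index (xs⊆ys (∈-lookup i))

    position-injective : ∀ {i j} → position i ≡ position j → i ≡ j
    position-injective {i} {j} eq = Unique-lookup-injective u
      (trans (lookup-position i) (trans (cong (lookup ys) eq) (sym (lookup-position j))))

_∖_ : ∀ {V : Set} → (V → Set) → V → V → Set
(P ∖ d) z = P z × z ≢ d

module Walks {V : Set} (R : V → V → Set) where

  -- A walk given by the list of all its vertices, endpoints included; unlike Walk it may
  -- have no edge.
  data VWalk : V → V → List V → Set where
    nil  : ∀ {a} → VWalk a a [ a ]
    cons : ∀ {a b c L} → R a b → VWalk b c L → VWalk a c (a ∷ L)

  Linked : (V → Set) → V → V → Set
  Linked Q a b = ∃[ L ] (VWalk a b L × All Q L)

  fromWalk : ∀ {a b is} → Walk R a b is → VWalk a b ((a ∷ is) ∷ʳ b)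
  fromWalk (edge r)   = cons r nil
  fromWalk (step r w) = cons r (fromWalk w)

  first∈ : ∀ {a b L} → VWalk a b L → a ∈ₗ L
  first∈ nil        = here refl
  first∈ (cons _ _) = here refl

  last∈ : ∀ {a b L} → VWalk a b L → b ∈ₗ L
  last∈ nil        = here refl
  last∈ (cons _ w) = there (last∈ w)

  module _ {Q : V → Set} where

    linked-ends : ∀ {a b} → Linked Q a b → Q a × Q b
    linked-ends (_ , w , qs) = All.lookup qs (first∈ w) , All.lookup qs (last∈ w)

    linked-refl : ∀ {a} → Q a → Linked Q a a
    linked-refl q = _ , nil , q ∷ []

    linked-cons : ∀ {a b c} → R a b → Q a → Linked Q b c → Linked Q a c
    linked-cons r q (_ , w , qs) = _ , cons r w , q ∷ qs

    linked-trans : ∀ {a b c} → Linked Q a b → Linked Q b c → Linked Q a c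
    linked-trans (_ , nil , _)             l = l
    linked-trans (_ , cons r w , q ∷ qs)   l = linked-cons r q (linked-trans (_ , w , qs) l)

  linked-mono : ∀ {Q Q' : V → Set} → (∀ {z} → Q z → Q' z) → ∀ {a b} → Linked Q a b → Linked Q' a b
  linked-mono f (L , w , qs) = L , w , All.map f qs

  suffix : ∀ {a b w L} → VWalk a b L → w ∈ₗ L → ∃[ L' ] (VWalk w b L' × L' SL.⊆ L)
  suffix nil        (here refl) = _ , nil , SL.⊆-refl
  suffix (cons r g) (here refl) = _ , cons r g , SL.⊆-refl
  suffix (cons r g) (there w∈)  with suffix g w∈
  ... | L' , g' , σ = L' , g' , _ SL.∷ʳ σ

  linked-suffix : ∀ {a b w L} → VWalk a b L → w ∈ₗ L → Linked (_∈ₗ L) w b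
  linked-suffix g w∈ with suffix g w∈
  ... | L' , g' , σ = L' , g' , All.tabulate (SL.lookup σ)

  split-at : ∀ {a b w L} → Unique L → VWalk a b L → w ∈ₗ L → w ≢ a → w ≢ b →
             ∃₂ λ h₁ h₂ → R h₁ w × R w h₂ × h₁ ≢ h₂ ×
               Linked ((_∈ₗ L) ∖ w) a h₁ × Linked ((_∈ₗ L) ∖ w) h₂ b
  split-at _ nil          (here refl)          w≢a _   = ⊥-elim (w≢a refl)
  split-at _ (cons _ _)   (here refl)          w≢a _   = ⊥-elim (w≢a refl)
  split-at _ (cons _ nil) (there (here refl))  _   w≢b = ⊥-elim (w≢b refl)
  split-at _ (cons _ nil) (there (there ()))   _   _
  split-at (a∉ ∷ w∉ ∷ _) (cons r (cons r' g)) (there (here refl)) _ _ =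
    _ , _ , r , r' , All.lookup a∉ (there (first∈ g)) ,
    linked-refl (here refl , All.lookup a∉ (here refl)) ,
    linked-mono (λ z∈ → there (there z∈) , All.lookup w∉ z∈ ∘ sym) (linked-suffix g (first∈ g))
  split-at (a∉ ∷ u@(a'∉ ∷ _)) (cons r g@(cons _ _)) (there (there w∈)) _ w≢b
    with split-at u g (there w∈) (All.lookup a'∉ w∈ ∘ sym) w≢b
  ... | h₁ , h₂ , r₁ , r₂ , h₁≢h₂ , pre , post =
    h₁ , h₂ , r₁ , r₂ , h₁≢h₂ ,
    linked-cons r (here refl , All.lookup a∉ (there w∈)) (linked-mono (map₁ there) pre) ,
    linked-mono (map₁ there) post

  module _ (_≟ᵥ_ : DecidableEquality V) where
    open DecMembership _≟ᵥ_ using () renaming (_∈?_ to _∈ₗ?_)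

    loop-erase : ∀ {a b L} → VWalk a b L → ∃[ L' ] (VWalk a b L' × Unique L' × L' SL.⊆ L)
    loop-erase nil = _ , nil , [] ∷ [] , SL.⊆-refl
    loop-erase {a = a} (cons r g) with loop-erase g
    ... | L' , g' , u' , σ with a ∈ₗ? L'
    ...   | yes a∈ with suffix g' a∈
    ...     | L'' , g'' , τ = L'' , g'' , Unique-resp-⊇ τ u' , _ SL.∷ʳ SL.⊆-trans τ σ
    loop-erase (cons r g) | L' , g' , u' , σ | no a∉ =
      _ , cons r g' , ¬Any⇒All¬ L' a∉ ∷ u' , refl SL.∷ σ

  module _ (R-sym : Symmetric R) where

    linked-sym : ∀ {Q a b} → Linked Q a b → Linked Q b a
    linked-sym (_ , nil , qs) = _ , nil , qs
    linked-sym (_ , cons r g , q ∷ qs) =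
      linked-trans (linked-sym (_ , g , qs))
                   (linked-cons (R-sym r) (All.lookup qs (first∈ g)) (linked-refl q))

    linked-prefix : ∀ {a b w L} → VWalk a b L → w ∈ₗ L → Linked (_∈ₗ L) w a
    linked-prefix g w∈ = linked-trans (linked-suffix g w∈) (linked-sym (_ , g , All.tabulate id))

    module _ (_≟ᵥ_ : DecidableEquality V) where

      linked-to-end-avoiding : ∀ {a b w d L} → Unique L → VWalk a b L → w ∈ₗ L → w ≢ d →
                               Linked ((_∈ₗ L) ∖ d) w a ⊎ Linked ((_∈ₗ L) ∖ d) w b
      linked-to-end-avoiding _ nil        (here refl) w≢d = inj₁ (linked-refl (here refl , w≢d))
      linked-to-end-avoiding _ (cons _ _) (here refl) w≢d = inj₁ (linked-refl (here refl , w≢d))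
      linked-to-end-avoiding {a = a} {d = d} (a∉ ∷ u) (cons r g) (there w∈) w≢d with d ≟ᵥ a
      ... | yes refl =
        inj₂ (linked-mono (λ z∈ → there z∈ , All.lookup a∉ z∈ ∘ sym) (linked-suffix g w∈))
      ... | no d≢a with linked-to-end-avoiding u g w∈ w≢d
      ...   | inj₂ l = inj₂ (linked-mono (map₁ there) l)
      ...   | inj₁ l = inj₁ (linked-trans (linked-mono (map₁ there) l)
                         (linked-cons (R-sym r) (map₁ there (proj₂ (linked-ends l)))
                           (linked-refl (here refl , d≢a ∘ sym))))

fromList : ∀ {n} → List (Fin n) → Subset n
fromList []       = ∅
fromList (z ∷ zs) = ⁅ z ⁆ ∪ fromList zs

∈-fromList⁺ : ∀ {n} {z : Fin n} {zs} → z ∈ₗ zs → z ∈ fromList zs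
∈-fromList⁺ (here refl) = x∈p∪q⁺ (inj₁ (x∈⁅x⁆ _))
∈-fromList⁺ (there z∈)  = x∈p∪q⁺ (inj₂ (∈-fromList⁺ z∈))

∈-fromList⁻ : ∀ {n} {z : Fin n} zs → z ∈ fromList zs → z ∈ₗ zs
∈-fromList⁻ []       z∈ = ⊥-elim (∉⊥ z∈)
∈-fromList⁻ (y ∷ zs) z∈ with x∈p∪q⁻ ⁅ y ⁆ (fromList zs) z∈
... | inj₁ z∈⁅y⁆ = here (x∈⁅y⁆⇒x≡y y z∈⁅y⁆)
... | inj₂ z∈zs  = there (∈-fromList⁻ zs z∈zs)

module _ {n : ℕ} {p q r : Subset n} where

  x∈p∪q∪r⁻ : ∀ {z} → z ∈ p ∪ q ∪ r → z ∈ p ⊎ z ∈ q ⊎ z ∈ r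
  x∈p∪q∪r⁻ = Sum.map₂ (x∈p∪q⁻ q r) ∘ x∈p∪q⁻ p (q ∪ r)

  q⊆p∪q∪r : q ⊆ p ∪ q ∪ r
  q⊆p∪q∪r z∈q = q⊆p∪q p _ (p⊆p∪q r z∈q)

  r⊆p∪q∪r : r ⊆ p ∪ q ∪ r
  r⊆p∪q∪r z∈r = q⊆p∪q p _ (q⊆p∪q q r z∈r)


module _ {n : ℕ} (G : Graph n) where
  open Graph G renaming (sym to Adj-sym)
  open Walks Adj
  open DecMembership (_≟_ {n}) using () renaming (_∈?_ to _∈ₗ?_)

  linked⇒reach : ∀ {Q u v} → Linked Q u v → Reach G Q u v
  linked⇒reach (_ , nil , _) = inj₁ refl
  linked⇒reach (_ , cons r g , _ ∷ qs) with linked⇒reach (_ , g , qs)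
  ... | inj₁ refl              = inj₂ ([] , edge r , [])
  ... | inj₂ (is , walk , qis) = inj₂ (_ ∷ is , step r walk , All.lookup qs (first∈ g) ∷ qis)

  reach⇒linked : ∀ {Q u v} → Q u → Q v → Reach G Q u v → Linked Q u v
  reach⇒linked qu _  (inj₁ refl)             = linked-refl qu
  reach⇒linked qu qv (inj₂ (_ , walk , qis)) = _ , fromWalk walk , qu ∷ ++⁺ qis (qv ∷ [])

  connectedOn⇒linked : ∀ {P u v} → ConnectedOn G P → P u → P v → Linked P u v
  connectedOn⇒linked connected pu pv = reach⇒linked pu pv (connected _ _ pu pv)

  hub⇒connectedOn : ∀ {P h} → (∀ {p} → P p → Linked P p h) → ConnectedOn G P
  hub⇒connectedOn hub _ _ pp pq = linked⇒reach (linked-trans (hub pp) (linked-sym Adj-sym (hub pq)))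

  hub⇒¬cutVertexOn : ∀ {P d h} → (∀ {p} → P p → p ≢ d → DoubleNegation (Linked (P ∖ d) p h)) →
                     ¬ IsCutVertexOn G P d
  hub⇒¬cutVertexOn hub (_ , _ , _ , pp , pq , p≢d , q≢d , _ , ¬reach) =
    (do lp ← hub pp p≢d
        lq ← hub pq q≢d
        pure (linked⇒reach (linked-trans lp (linked-sym Adj-sym lq)))) ¬reach

  twoConn-linked : ∀ {S a b d} → TwoConn G S → a ∈ S → b ∈ S → a ≢ d → b ≢ d →
                   DoubleNegation (Linked ((_∈ S) ∖ d) a b)
  twoConn-linked {S} {d = d} (_ , connected , ¬cut) a∈S b∈S a≢d b≢d with d ∈? S
  ... | yes d∈S = λ ¬linked → ¬cut d (d∈S , _ , _ , a∈S , b∈S , a≢d , b≢d , connected _ _ a∈S b∈S ,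
                                      ¬linked ∘ reach⇒linked (a∈S , a≢d) (b∈S , b≢d))
  ... | no d∉S  = pure (linked-mono (λ z∈S → z∈S , λ z≡d → d∉S (subst (_∈ S) z≡d z∈S))
                                    (connectedOn⇒linked connected a∈S b∈S))

  module _ {S S' : Subset n} {c x y : Fin n} {L : List (Fin n)}
           (S-2c : TwoConn G S) (S'-2c : TwoConn G S') (c∈S : c ∈ S) (c∈S' : c ∈ S')
           (x∈S : x ∈ S) (y∈S' : y ∈ S') (path : VWalk x y L) (L-unique : Unique L)
           (path-avoids-c : All (_≢ c) L) where

    private
      T : Subset n
      T = S ∪ S' ∪ fromList L

      S⊆T : S ⊆ T
      S⊆T = p⊆p∪q _

      L⊆T : ∀ {z} → z ∈ₗ L → z ∈ T
      L⊆T = r⊆p∪q∪r ∘ ∈-fromList⁺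

      ∈T-cases : ∀ {z} → z ∈ T → z ∈ S ⊎ z ∈ S' ⊎ z ∈ₗ L
      ∈T-cases = Sum.map₂ (Sum.map₂ (∈-fromList⁻ L)) ∘ x∈p∪q∪r⁻

      linked-S : ∀ {d a b} → Linked ((_∈ S) ∖ d) a b → Linked ((_∈ T) ∖ d) a b
      linked-S = linked-mono (map₁ S⊆T)

      linked-S' : ∀ {d a b} → Linked ((_∈ S') ∖ d) a b → Linked ((_∈ T) ∖ d) a b
      linked-S' = linked-mono (map₁ q⊆p∪q∪r)

      linked-L : ∀ {d a b} → Linked ((_∈ₗ L) ∖ d) a b → Linked ((_∈ T) ∖ d) a b
      linked-L = linked-mono (map₁ L⊆T)

      x≢c : x ≢ c
      x≢c = All.lookup path-avoids-c (first∈ path)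

      y≢c : y ≢ c
      y≢c = All.lookup path-avoids-c (last∈ path)

      path-avoiding-c : Linked ((_∈ T) ∖ c) x y
      path-avoiding-c = _ , path , All.tabulate (λ z∈L → L⊆T z∈L , All.lookup path-avoids-c z∈L)

      linked-to-c : ∀ {z} → z ∈ T → Linked (_∈ T) z c
      linked-to-c z∈T with ∈T-cases z∈T
      ... | inj₁ z∈S         = linked-mono S⊆T (connectedOn⇒linked (proj₁ (proj₂ S-2c)) z∈S c∈S)
      ... | inj₂ (inj₁ z∈S') = linked-mono q⊆p∪q∪r (connectedOn⇒linked (proj₁ (proj₂ S'-2c)) z∈S' c∈S')
      ... | inj₂ (inj₂ z∈L)  = linked-trans (linked-mono L⊆T (linked-prefix Adj-sym path z∈L))
                                 (linked-mono S⊆T (connectedOn⇒linked (proj₁ (proj₂ S-2c)) x∈S c∈S))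

      linked-to-x-avoiding-c : ∀ {z} → z ∈ T → z ≢ c → DoubleNegation (Linked ((_∈ T) ∖ c) z x)
      linked-to-x-avoiding-c z∈T z≢c with ∈T-cases z∈T
      ... | inj₁ z∈S         = linked-S <$> twoConn-linked S-2c z∈S x∈S z≢c x≢c
      ... | inj₂ (inj₁ z∈S') = (λ l → linked-trans (linked-S' l) (linked-sym Adj-sym path-avoiding-c))
                                 <$> twoConn-linked S'-2c z∈S' y∈S' z≢c y≢c
      ... | inj₂ (inj₂ z∈L)  = pure (linked-mono (λ z∈L → L⊆T z∈L , All.lookup path-avoids-c z∈L)
                                                 (linked-prefix Adj-sym path z∈L))

      linked-to-c-avoiding : ∀ {z d} → c ≢ d → z ∈ T → z ≢ d → DoubleNegation (Linked ((_∈ T) ∖ d) z c)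
      linked-to-c-avoiding c≢d z∈T z≢d with ∈T-cases z∈T
      ... | inj₁ z∈S         = linked-S <$> twoConn-linked S-2c z∈S c∈S z≢d c≢d
      ... | inj₂ (inj₁ z∈S') = linked-S' <$> twoConn-linked S'-2c z∈S' c∈S' z≢d c≢d
      ... | inj₂ (inj₂ z∈L)  with linked-to-end-avoiding Adj-sym _≟_ L-unique path z∈L z≢d
      ...   | inj₁ l = linked-trans (linked-L l) ∘ linked-S <$>
                         twoConn-linked S-2c x∈S c∈S (proj₂ (proj₂ (linked-ends l))) c≢d
      ...   | inj₂ l = linked-trans (linked-L l) ∘ linked-S' <$>
                         twoConn-linked S'-2c y∈S' c∈S' (proj₂ (proj₂ (linked-ends l))) c≢d

      -- Removing d ≠ c, everything still reaches c; removing c, the path joins S' to x.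
      ¬cutVertex : ∀ d → ¬ IsCutVertexOn G (_∈ T) d
      ¬cutVertex d with c ≟ d
      ... | yes refl = hub⇒¬cutVertexOn linked-to-x-avoiding-c
      ... | no c≢d   = hub⇒¬cutVertexOn (linked-to-c-avoiding c≢d)

    twoConn-∪-path : TwoConn G (S ∪ S' ∪ fromList L)
    twoConn-∪-path = (c , S⊆T c∈S) , hub⇒connectedOn linked-to-c , ¬cutVertex

  blocks-separated : ∀ {S S' c x y} → IsBlock G S → IsBlock G S' → S ≢ S' →
                     c ∈ S → c ∈ S' → x ∈ S → y ∈ S' → ¬ Linked (_≢ c) x y
  blocks-separated {S} {S'} (S-2c , S-max) (S'-2c , S'-max) S≢S' c∈S c∈S' x∈S y∈S' (_ , walk , avoids)
    with loop-erase _≟_ walk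
  ... | L , path , L-unique , σ =
    S≢S' (⊆-antisym (λ z∈S → S'-max _ q⊆p∪q∪r T-2c (p⊆p∪q _ z∈S))
                    (λ z∈S' → S-max _ (p⊆p∪q _) T-2c (q⊆p∪q∪r z∈S')))
    where
    T-2c : TwoConn G (S ∪ S' ∪ fromList L)
    T-2c = twoConn-∪-path S-2c S'-2c c∈S c∈S' x∈S y∈S' path L-unique (anti-mono (SL.lookup σ) avoids)

  Separates : Fin n → Fin n → Fin n → Set
  Separates c u v = u ≢ c × v ≢ c × ¬ Linked (_≢ c) u v

  separator∈walk : ∀ {c u v ps} → Separates c u v → Walk Adj u v ps → c ∈ₗ ps
  separator∈walk {c} {ps = ps} (u≢c , v≢c , ¬linked) walk = decidable-stable (c ∈ₗ? ps) λ c∉ps →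
    ¬linked (_ , fromWalk walk , u≢c ∷ ++⁺ (All.map (_∘ sym) (¬Any⇒All¬ ps c∉ps)) (v≢c ∷ []))

  SeparatingCut : Subset n → Fin n → Fin n → HV n → Set
  SeparatingCut X u v (cutV c) = c ∈ X × Separates c u v
  SeparatingCut X u v (blkV _) = ⊥

  separating-cuts-bounded : ∀ {X k u v hs} → MutualVisible G X k → u ∈ X → v ∈ X →
                            Unique hs → All (SeparatingCut X u v) hs → length hs ≤ k
  separating-cuts-bounded _ _ _ _ [] = z≤n
  separating-cuts-bounded {hs = blkV _ ∷ _} _ _ _ _ (() ∷ _)
  separating-cuts-bounded {X} {k} {u} {v} {hs@(cutV c ∷ _)} visible u∈X v∈X hs-unique
                          hs-separating@((_ , u≢c , _ , ¬linked) ∷ _)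
    with visible u v u∈X v∈X (λ u≡v → ¬linked (subst (Linked (_≢ c) u) u≡v (linked-refl u≢c)))
  ... | ps , (walk , _) , count≤k =
    ≤-trans (Unique-length-mono-≤ hs-unique hs⊆ps)
            (subst (_≤ k) (sym (length-map cutV (filter (_∈? X) ps))) count≤k)
    where
    hs⊆ps : hs ⊆ₛ map cutV (filter (_∈? X) ps)
    hs⊆ps {blkV _} h∈hs = ⊥-elim (All.lookup hs-separating h∈hs)
    hs⊆ps {cutV c'} h∈hs with All.lookup hs-separating h∈hs
    ... | c'∈X , separates = ∈-map⁺ cutV (∈-filter⁺ (_∈? X) (separator∈walk separates walk) c'∈X)

module _ {n : ℕ} (G : Graph n) where
  open Graph G using (Adj) renaming (sym to Adj-sym)
  open Walks Adj
  module H = Walks (HAdj G)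

  HAdj-sym : Symmetric (HAdj G)
  HAdj-sym {cutV _} {blkV _} a∈S = a∈S
  HAdj-sym {blkV _} {cutV _} a∈S = a∈S

  LinkedAvoiding : Fin n → Fin n → HV n → Set
  LinkedAvoiding c u (cutV a) = Linked (_≢ c) u a
  LinkedAvoiding c u (blkV S) = ∃[ x ] (x ∈ S × Linked (_≢ c) u x)

  linkedAvoiding⇒≢ : ∀ {c u h} → LinkedAvoiding c u h → u ≢ c
  linkedAvoiding⇒≢ {h = cutV _} l           = proj₁ (linked-ends l)
  linkedAvoiding⇒≢ {h = blkV _} (_ , _ , l) = proj₁ (linked-ends l)

  linkedAvoiding-step : ∀ {c u h h'} → IsHVertex G h → HAdj G h h' → h' ≢ cutV c →
                        LinkedAvoiding c u h → DoubleNegation (LinkedAvoiding c u h')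
  linkedAvoiding-step {h = cutV a} {blkV S} _ a∈S _ l = pure (a , a∈S , l)
  linkedAvoiding-step {h = blkV S} {cutV a} S-block a∈S a≢c (x , x∈S , l) =
    (λ l' → linked-trans l (linked-mono proj₂ l')) <$>
      twoConn-linked G (proj₁ S-block) x∈S a∈S (proj₂ (linked-ends l)) (a≢c ∘ cong cutV)

  linkedAvoiding-transport : ∀ {c u h h'} → H.Linked (λ h → IsHVertex G h × h ≢ cutV c) h h' →
                             LinkedAvoiding c u h → DoubleNegation (LinkedAvoiding c u h')
  linkedAvoiding-transport (_ , H.nil , _) l = pure l
  linkedAvoiding-transport (_ , H.cons r g , (h-vertex , _) ∷ qs) l = do
    l' ← linkedAvoiding-step h-vertex r (proj₂ (All.lookup qs (H.first∈ g))) l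
    linkedAvoiding-transport (_ , g , qs) l'

  interior-cut-separates : ∀ {α β L c u v} → Unique L → H.VWalk α β L → All (IsHVertex G) L →
                           cutV c ∈ₗ L → cutV c ≢ α → cutV c ≢ β →
                           LinkedAvoiding c u α → LinkedAvoiding c v β → ¬ Linked (_≢ c) u v
  interior-cut-separates {L = L} {c} L-unique path L-vertices c∈L c≢α c≢β uα vβ uv
    with H.split-at L-unique path c∈L c≢α c≢β
  ... | cutV _ , _ , () , _
  ... | blkV _ , cutV _ , _ , () , _
  ... | blkV B , blkV B' , c∈B , c∈B' , h₁≢h₂ , pre , post =
    (do x , x∈B , ux ← linkedAvoiding-transport (H.linked-mono on-path pre) uα
        y , y∈B' , vy ← linkedAvoiding-transport (H.linked-mono on-path (H.linked-sym HAdj-sym post)) vβ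
        pure (blocks-separated G B-block B'-block (h₁≢h₂ ∘ cong blkV) c∈B c∈B' x∈B y∈B'
                (linked-trans (linked-sym Adj-sym ux) (linked-trans uv vy)))) id
    where
    on-path : ∀ {h} → h ∈ₗ L × h ≢ cutV c → IsHVertex G h × h ≢ cutV c
    on-path = map₁ (All.lookup L-vertices)

    B-block : IsBlock G B
    B-block = All.lookup L-vertices (proj₁ (proj₂ (H.linked-ends pre)))

    B'-block : IsBlock G B'
    B'-block = All.lookup L-vertices (proj₁ (proj₁ (H.linked-ends post)))

  record Representative (X : Subset n) (α : HV n) : Set where
    field
      vertex   : Fin n
      vertex∈X : vertex ∈ X
      linked   : ∀ {c} → IsCut G c → cutV c ≢ α → LinkedAvoiding c vertex α

  open Representative

  representative : ∀ {X α} → ZOf G X α → Representative X α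
  representative {α = cutV a} (_ , a∈X) = record
    { vertex = a ; vertex∈X = a∈X ; linked = λ _ c≢a → linked-refl (c≢a ∘ cong cutV ∘ sym) }
  representative {α = blkV S} (_ , w , w∈S , w-not-cut , w∈X) = record
    { vertex = w ; vertex∈X = w∈X
    ; linked = λ c-cut _ → w , w∈S , linked-refl (λ w≡c → w-not-cut (subst (IsCut G) (sym w≡c) c-cut)) }

  ZOf⇒IsHVertex : ∀ {X α} → ZOf G X α → IsHVertex G α
  ZOf⇒IsHVertex {α = cutV _} = proj₁
  ZOf⇒IsHVertex {α = blkV _} = proj₁

  Z∩A-on-path-separating : ∀ {X α β is h} (Zα : ZOf G X α) (Zβ : ZOf G X β) → HPath G α β is →
    h ∈ₗ is → ZOf G X h × InA G h →
    SeparatingCut G X (vertex (representative Zα)) (vertex (representative Zβ)) h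
  Z∩A-on-path-separating {h = blkV _} _ _ _ _ (_ , ())
  Z∩A-on-path-separating {α = α} {β} {is} {cutV c} Zα Zβ (walk , is-vertices , unique) c∈is
                         ((c-cut , c∈X) , _) =
    c∈X , linkedAvoiding⇒≢ uα , linkedAvoiding⇒≢ vβ ,
    interior-cut-separates unique (H.fromWalk walk) L-vertices (there (∈-++⁺ˡ c∈is)) c≢α c≢β uα vβ
    where
    c≢α : cutV c ≢ α
    c≢α = Unique-pair⇒≢ (refl SL.∷ SL.from∈ (∈-++⁺ˡ c∈is)) unique ∘ sym

    c≢β : cutV c ≢ β
    c≢β = Unique-pair⇒≢ (_ SL.∷ʳ SLP.++⁺ (SL.from∈ c∈is) SL.⊆-refl) unique

    uα : LinkedAvoiding c (vertex (representative Zα)) α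
    uα = linked (representative Zα) c-cut c≢α

    vβ : LinkedAvoiding c (vertex (representative Zβ)) β
    vβ = linked (representative Zβ) c-cut c≢β

    L-vertices : All (IsHVertex G) ((α ∷ is) ∷ʳ β)
    L-vertices = ZOf⇒IsHVertex Zα ∷ ++⁺ is-vertices (ZOf⇒IsHVertex Zβ ∷ [])

lemma5p3 : ∀ {n : ℕ} (G : Graph n) → Connected G → IsBlockGraph G →
           (k : ℕ) (X : Subset n) → MutualVisible G X k →
           KAdmissible G (ZOf G X) k
lemma5p3 G _ _ k X visible α β Zα Zβ _ is path@(_ , _ , unique) js js⊆is js∈Z∩A =
  separating-cuts-bounded G visible
    (vertex∈X (representative G Zα)) (vertex∈X (representative G Zβ))
    (Unique-resp-⊇ (SL.⊆-trans js⊆is (α SL.∷ʳ SLP.++⁺ʳ [ β ] SL.⊆-refl)) unique)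
    (All.tabulate λ h∈js →
      Z∩A-on-path-separating G Zα Zβ path (SL.lookup js⊆is h∈js) (All.lookup js∈Z∩A h∈js))
  where open Representative
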